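{- Let $\preceq$ be an $n$-ordering system on a set $X$. Then the collection of all $\preceq$-closed subsets of $X$ has VC-dimension at most $n$.
   Context: For $0<n<\omega$, an $n$-ordering system on a set $X$ is a function assigning to each $s\in[X]^{<n}$ a relation $\preceq_s\subseteq X^2$, defined recursively: a $1$-ordering system is one in which $\preceq_\emptyset$ is a non-strict well-order of $X$; for $n>1$, $\preceq$ is an $n$-ordering system if $\preceq_\emptyset$ is a non-strict well-order of $X$ and for every $x_0\in X$ the function $\preceq^{x_0}$ on $[X_{\prec_\emptyset x_0}]^{<n-1}$ given by $\preceq^{x_0}_t=\preceq_{t\cup\{x_0\}}$ is an $(n-1)$-ordering system on $X_{\prec_\emptyset x_0}=\{x\in X:x\prec_\emptyset x_0\}$. Here $\prec_s$ is $\preceq_s$ minus the diagonal and $\mathrm{dom}(\preceq_s)=\{x:(x,x)\in\preceq_s\}$. A set $S\subseteq X$ is $\preceq$-closed if for every $s\subseteq S$ with $|s|=n-1$ and all $a,b\in\mathrm{dom}(\preceq_s)$, if $b\in S$ and $a\prec_s b$ then $a\in S$. A set $A$ is shattered by a family $\mathcal{F}$ if every subset of $A$ is of the form $A\cap S$ with $S\in\mathcal{F}$; the VC-dimension of $\mathcal{F}$ is the maximal size of a finite shattered set (or $\infty$). -}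

module Defs where

open import Data.Nat using (ℕ; zero; suc; _≤_)
open import Data.Fin using (Fin)
open import Data.Fin.Subset using (Subset; _∈_)
open import Data.List using (List; []; _∷_; length)
open import Data.List.Relation.Unary.All using (All)
open import Data.List.Relation.Unary.Unique.Propositional using (Unique)
open import Data.List.Relation.Binary.Permutation.Propositional using (_↭_)
open import Data.Product using (Σ; _×_; _,_)
open import Data.Sum using (_⊎_)
open import Relation.Binary.PropositionalEquality using (_≡_; _≢_)
open import Induction.WellFounded using (WellFounded)
open import Function.Definitions using (Injective)

Pred : Set → Set₁
Pred X = X → Set

Rel : Set → Set₁
Rel X = X → X → Set

module _ {X : Set} where

  Strict : Rel X → Rel X
  Strict R x y = R x y × x ≢ y

  Dom : Rel X → Pred X
  Dom R x = R x x

  record IsWellOrderOn (D : Pred X) (R : Rel X) : Set where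
    field
      within  : ∀ {x y} → R x y → D x × D y
      refl    : ∀ {x} → D x → R x x
      antisym : ∀ {x y} → R x y → R y x → x ≡ y
      trans   : ∀ {x y z} → R x y → R y z → R x z
      total   : ∀ {x y} → D x → D y → R x y ⊎ R y x
      wf      : WellFounded (Strict R)

  -- Finite subsets are represented by lists (of distinct elements); the
  -- theorem additionally requires invariance under permutation, so that
  -- ≼_s depends only on the set s.
  System : Set₁
  System = List X → Rel X

  -- IsOrdSys k D ≼ : ≼ is a (suc k)-ordering system on the subset D of X.
  -- The (n-1)-system ≼^{x0} is  t ↦ ≼_{t ∪ {x0}}, i.e. t ↦ ≼ (x0 ∷ t).
  IsOrdSys : ℕ → Pred X → System → Set
  IsOrdSys zero    D R = IsWellOrderOn D (R [])
  IsOrdSys (suc k) D R =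
    IsWellOrderOn D (R []) ×
    (∀ x₀ → D x₀ → IsOrdSys k (λ x → Strict (R []) x x₀) (λ t → R (x₀ ∷ t)))

  PermInvariant : System → Set
  PermInvariant R = ∀ {s s'} → s ↭ s' → ∀ {a b} → R s a b → R s' a b

  IsClosed : ℕ → System → Pred X → Set
  IsClosed n R S =
    ∀ (s : List X) → Unique s → length s ≡ n → All S s →
    ∀ {a b} → Dom (R s) a → Dom (R s) b → S b → Strict (R s) a b → S a

  Shatters : (Pred X → Set) → {m : ℕ} → (Fin m → X) → Set₁
  Shatters 𝓕 {m} a =
    ∀ (B : Subset m) → Σ (Pred X) λ S → 𝓕 S ×
      (∀ i → (S (a i) → i ∈ B) × (i ∈ B → S (a i)))

  VCdim≤ : (Pred X → Set) → ℕ → Set₁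
  VCdim≤ 𝓕 d = ∀ (m : ℕ) (a : Fin m → X) → Injective _≡_ _≡_ a → Shatters 𝓕 a → m ≤ d

-- A (k+1)-ordering system is built from a well-order ≼_∅ and, below each point x₀, a k-ordering
-- system ≼_{x₀ ∪ ·}. Given a shattered set, let x₀ be its ≼_∅-largest point. For a closed S ∋ x₀,
-- the trace of S strictly below x₀ is closed for the k-ordering system below x₀, and the traces of
-- the sets witnessing subsets containing x₀ shatter the remaining points. By induction the size
-- drops by one per level; at a single well-order closed sets are ≼_∅-downward closed, so no two
-- distinct points are shattered.
module Submission where

open import Defs
open import Data.Nat using (ℕ; suc; zero; _≤_; z≤n; s≤s)
open import Data.Unit using (⊤; tt)
open import Data.Fin using (Fin; punchIn) renaming (zero to fz; suc to fs)
open import Data.Fin.Properties using (0≢1+n; punchIn-injective; punchInᵢ≢i)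
open import Data.Fin.Subset using (Subset; ⁅_⁆; inside) renaming (_∈_ to _∈ₛ_)
open import Data.Fin.Subset.Properties using (x∈⁅x⁆; x∈⁅y⁆⇒x≡y)
open import Data.Vec using (insertAt)
open import Data.Vec.Properties using (insertAt-lookup; insertAt-punchIn; []=⇒lookup; lookup⇒[]=)
open import Data.List using (List; []; _∷_; length)
open import Data.List.Relation.Unary.All using (All; []; _∷_)
import Data.List.Relation.Unary.All as All
open import Data.List.Relation.Unary.Unique.Propositional using (Unique)
import Data.List.Relation.Unary.AllPairs as AllPairs
open import Data.Product using (Σ; _×_; _,_; proj₁; proj₂)
open import Data.Sum using (inj₁; inj₂)
open import Data.Empty using (⊥-elim)
open import Relation.Nullary using (¬_)
open import Relation.Binary.PropositionalEquality using (_≡_; refl; sym; trans; cong)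
open import Function.Base using (_$_)
open import Function.Definitions using (Injective)

module _ {m : ℕ} (B : Subset m) (j : Fin (suc m)) where

  ∈-insertAt : j ∈ₛ insertAt B j inside
  ∈-insertAt = lookup⇒[]= j _ (insertAt-lookup B j inside)

  punchIn∈-insertAt⇒∈ : ∀ {b i} → punchIn j i ∈ₛ insertAt B j b → i ∈ₛ B
  punchIn∈-insertAt⇒∈ {b} {i} p =
    lookup⇒[]= i B (trans (sym (insertAt-punchIn B j b i)) ([]=⇒lookup p))

  ∈⇒punchIn∈-insertAt : ∀ {b i} → i ∈ₛ B → punchIn j i ∈ₛ insertAt B j b
  ∈⇒punchIn∈-insertAt {b} {i} p =
    lookup⇒[]= (punchIn j i) _ (trans (insertAt-punchIn B j b i) ([]=⇒lookup p))

module _ {X : Set} where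

  -- Closedness relative to the domain D of a system: only points a of D need to be added.
  -- For D = ⊤ this is IsClosed; the relative form is what survives restriction below a point.
  IsClosedWithin : ℕ → Pred X → System {X} → Pred X → Set
  IsClosedWithin n D R S =
    ∀ (s : List X) → Unique s → length s ≡ n → All S s →
    ∀ {a b} → Dom (R s) a → Dom (R s) b → S b → Strict (R s) a b → D a → S a

  IsClosed⇒IsClosedWithin : ∀ {n R S} → IsClosed n R S → IsClosedWithin n (λ _ → ⊤) R S
  IsClosed⇒IsClosedWithin closed s u l all da db sb ab _ = closed s u l all da db sb ab

  argmax : ∀ {D : Pred X} {R : Rel X} → IsWellOrderOn D R →
    ∀ m (a : Fin (suc m) → X) → (∀ i → D (a i)) → Σ (Fin (suc m)) λ j → ∀ i → R (a i) (a j)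
  argmax W zero a Da = fz , λ { fz → IsWellOrderOn.refl W (Da fz) }
  argmax W (suc m) a Da with argmax W m (λ i → a (fs i)) (λ i → Da (fs i))
  ... | j , max with IsWellOrderOn.total W (Da fz) (Da (fs j))
  ... | inj₁ r = fs j , λ { fz → r ; (fs i) → max i }
  ... | inj₂ r = fz , λ { fz → IsWellOrderOn.refl W (Da fz)
                        ; (fs i) → IsWellOrderOn.trans W (max i) r }

  ¬shatters-strictPair : ∀ {D R m} → IsWellOrderOn D (R []) →
    (a : Fin m → X) (i j : Fin m) → D (a i) → D (a j) → Strict (R []) (a i) (a j) →
    ¬ Shatters (IsClosedWithin 0 D R) a
  ¬shatters-strictPair W a i j Dai Daj (ij , ai≢aj) shatters
    with shatters ⁅ j ⁆
  ... | S , closed , traces = ai≢aj (cong a (x∈⁅y⁆⇒x≡y j (proj₁ (traces i) Sai)))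
    where
    open IsWellOrderOn W renaming (refl to reflexive)
    Sai : S (a i)
    Sai = closed [] AllPairs.[] refl [] (reflexive Dai) (reflexive Daj)
                 (proj₂ (traces j) (x∈⁅x⁆ j)) (ij , ai≢aj) Dai

  shatters-below : ∀ {k D R m} → IsWellOrderOn D (R []) →
    (a : Fin (suc m) → X) → Injective _≡_ _≡_ a → (∀ i → D (a i)) →
    (j : Fin (suc m)) → (∀ i → R [] (a i) (a j)) →
    Shatters (IsClosedWithin (suc k) D R) a →
    Shatters (IsClosedWithin k (λ x → Strict (R []) x (a j)) (λ t → R (a j ∷ t)))
             (λ i → a (punchIn j i))
  shatters-below {R = R} W a inj Da j max shatters B
    with shatters (insertAt B j inside)
  ... | S , closed , traces = S' , closed' , traces'
    where
    open IsWellOrderOn W using (within)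
    Below : Pred X
    Below x = Strict (R []) x (a j)
    S' : Pred X
    S' x = S x × Below x
    closed' : IsClosedWithin _ Below (λ t → R (a j ∷ t)) S'
    closed' t u l allS' da db S'b ab below-a =
      closed (a j ∷ t) (All.map (λ x≺aj aj≡x → proj₂ (proj₂ x≺aj) (sym aj≡x)) allS' AllPairs.∷ u)
             (cong suc l) (proj₂ (traces j) (∈-insertAt B j) ∷ All.map proj₁ allS')
             da db (proj₁ S'b) ab (proj₁ (within (proj₁ below-a)))
      , below-a
    traces' : ∀ i → (S' (a (punchIn j i)) → i ∈ₛ B) × (i ∈ₛ B → S' (a (punchIn j i)))
    traces' i =
      (λ S'ai → punchIn∈-insertAt⇒∈ B j (proj₁ (traces (punchIn j i)) (proj₁ S'ai)))
      , λ i∈B → proj₂ (traces (punchIn j i)) (∈⇒punchIn∈-insertAt B j i∈B)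
              , max (punchIn j i) , λ eq → punchInᵢ≢i j i (inj eq)

  shattered-size≤ : ∀ k {D R} → IsOrdSys k D R →
    ∀ m (a : Fin m → X) → Injective _≡_ _≡_ a → (∀ i → D (a i)) →
    Shatters (IsClosedWithin k D R) a → m ≤ suc k
  shattered-size≤ zero W zero a inj Da shatters = z≤n
  shattered-size≤ zero W (suc zero) a inj Da shatters = s≤s z≤n
  shattered-size≤ zero W (suc (suc m)) a inj Da shatters
    with IsWellOrderOn.total W (Da fz) (Da (fs fz))
  ... | inj₁ r = ⊥-elim $ ¬shatters-strictPair W a fz (fs fz) (Da fz) (Da (fs fz))
                   (r , λ eq → 0≢1+n (inj eq)) shatters
  ... | inj₂ r = ⊥-elim $ ¬shatters-strictPair W a (fs fz) fz (Da (fs fz)) (Da fz)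
                   (r , λ eq → 0≢1+n (sym (inj eq))) shatters
  shattered-size≤ (suc k) W zero a inj Da shatters = z≤n
  shattered-size≤ (suc k) (W , below) (suc m) a inj Da shatters =
    s≤s (shattered-size≤ k (below (a j) (Da j)) m (λ i → a (punchIn j i))
           (λ eq → punchIn-injective j _ _ (inj eq))
           (λ i → max (punchIn j i) , λ eq → punchInᵢ≢i j i (inj eq))
           (shatters-below W a inj Da j max shatters))
    where
    j = proj₁ (argmax W m a Da)
    max = proj₂ (argmax W m a Da)

proposition2p17 : (X : Set) (k : ℕ) (R : System {X}) →
    IsOrdSys k (λ _ → ⊤) R → PermInvariant R →
    VCdim≤ (IsClosed k R) (suc k)
proposition2p17 X k R W _ m a inj shatters =
  shattered-size≤ k W m a inj (λ _ → tt) λ B →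
    let (S , closed , traces) = shatters B in S , IsClosed⇒IsClosedWithin closed , traces
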